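{- Let $p\ge 1$ be an integer, let $G$ be a graph, and let $L,R$ be a partition of $V(G)$ such that $\mathrm{pp}^3_L(x)\le p$ for all $x\in R$; let $v\in R$. For $X\subseteq V(G)$ and $u\in X$ put $T_1=\mathrm{Target}^1_X(u)$, $T_2=\mathrm{Target}^2_X(u)\setminus T_1$, $T_3=\mathrm{Target}^3_X(u)\setminus(T_1\cup T_2)$ and define $\phi_X(u)=|T_1|p^2+|T_2|p+|T_3|$. Then for every $u\in L$: if $v\in \mathrm{Target}^3_{L\cup\{v\}}(u)$ then $\phi_{L\cup\{v\}}(u)>\phi_L(u)$, and otherwise $\phi_{L\cup\{v\}}(u)=\phi_L(u)$.
   Context: All graphs are finite and simple; length of a path = number of edges. For $L\subseteq V(G)$, a path avoids $L$ if none of its inner vertices lies in $L$ (endpoints may). A path from $v$ to $x$ is $(r,L)$-admissible if it has length at most $r$ and avoids $L$. $\mathrm{Target}^r_L(v)$ is the set of $x \in L$, $x\ne v$, reachable from $v$ by an $(r,L)$-admissible path. An $(r,L)$-admissible packing rooted at $v$ is a collection of $(r,L)$-admissible paths $vP_1x_1,\dots,vP_kx_k$ such that the sequences $P_ix_i$ (paths with $v$ removed) are pairwise vertex-disjoint and each $x_i \in \mathrm{Target}^r_L(v)$. $\mathrm{pp}^r_L(v)$ is the maximum number of paths in such a packing rooted at $v$. -}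

module Defs where

open import Data.Nat using (ℕ; zero; suc; _+_; _*_; _≤_)
open import Data.Fin using (Fin)
open import Data.Fin.Subset using (Subset; _∈_; _∉_)
open import Data.List using (List; []; _∷_; _++_; [_]; length; concatMap; map; allFin)
open import Data.Nat.ListAction using (sum)
open import Data.List.Relation.Unary.All using (All)
open import Data.List.Relation.Unary.Linked using (Linked)
open import Data.List.Relation.Unary.Unique.Propositional using (Unique)
open import Data.Product using (Σ; _×_; _,_; ∃; proj₁; proj₂)
open import Data.Sum using (_⊎_)
open import Data.Bool using (if_then_else_)
open import Relation.Nullary using (¬_; Dec; does; yes; no; _×-dec_; _⊎-dec_; ¬?)
open import Relation.Binary.PropositionalEquality using (_≡_; _≢_)

record Graph (n : ℕ) : Set₁ where
  field
    Adj   : Fin n → Fin n → Set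
    sym   : ∀ {x y} → Adj x y → Adj y x
    irrefl : ∀ {x} → ¬ Adj x x

module _ {n : ℕ} (G : Graph n) where
  open Graph G

  IsPath : Fin n → List (Fin n) → Fin n → Set
  IsPath v inner x = Linked Adj (v ∷ inner ++ [ x ]) × Unique (v ∷ inner ++ [ x ])

  pathLength : List (Fin n) → ℕ
  pathLength inner = suc (length inner)

  Admissible : ℕ → Subset n → Fin n → List (Fin n) → Fin n → Set
  Admissible r L v inner x =
    IsPath v inner x × pathLength inner ≤ r × All (λ w → w ∉ L) inner

  Target : ℕ → Subset n → Fin n → Fin n → Set
  Target r L v x = x ∈ L × x ≢ v × Σ (List (Fin n)) (λ inner → Admissible r L v inner x)

  -- An (r , L)-admissible packing rooted at v: a list of paths v P_i x_i
  -- (given as pairs (P_i , x_i)), each admissible with x_i ∈ Target^r_L(v),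
  -- such that the sequences P_i x_i are pairwise vertex-disjoint
  -- (equivalently, their concatenation has no repeated vertex).
  IsPacking : ℕ → Subset n → Fin n → List (List (Fin n) × Fin n) → Set
  IsPacking r L v ps =
    All (λ q → Admissible r L v (proj₁ q) (proj₂ q) × Target r L v (proj₂ q)) ps
    × Unique (concatMap (λ q → proj₁ q ++ [ proj₂ q ]) ps)

  ppAtMost : ℕ → Subset n → Fin n → ℕ → Set
  ppAtMost r L v p = ∀ ps → IsPacking r L v ps → length ps ≤ p

  count : (P : Fin n → Set) → (∀ x → Dec (P x)) → ℕ
  count P d = sum (map (λ x → if does (d x) then 1 else 0) (allFin n))

  -- A decision procedure for membership in Target sets (always exists, as
  -- everything is finite; it is taken as a parameter so that counting is
  -- constructive; the counts do not depend on the choice).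
  TargetDecider : Set
  TargetDecider = ∀ r X u x → Dec (Target r X u x)

  T₁ T₂ T₃ : Subset n → Fin n → Fin n → Set
  T₁ X u x = Target 1 X u x
  T₂ X u x = Target 2 X u x × ¬ T₁ X u x
  T₃ X u x = Target 3 X u x × ¬ (T₁ X u x ⊎ T₂ X u x)

  φ : TargetDecider → ℕ → Subset n → Fin n → ℕ
  φ dT p X u =
      count (T₁ X u) d₁ * (p * p)
    + count (T₂ X u) d₂ * p
    + count (T₃ X u) d₃
    where
      d₁ : ∀ x → Dec (T₁ X u x)
      d₁ x = dT 1 X u x
      d₂ : ∀ x → Dec (T₂ X u x)
      d₂ x = dT 2 X u x ×-dec ¬? (d₁ x)
      d₃ : ∀ x → Dec (T₃ X u x)
      d₃ x = dT 3 X u x ×-dec ¬? (d₁ x ⊎-dec d₂ x)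

module Submission where

-- φ_X(u) is a sum over vertices x of a weight p², p, 1 or 0, according to the least r with
-- x ∈ Target^r_X(u). Adding v to L only affects paths through v, and such a path splits into a
-- u–v part avoiding L ∪ {v} and a v–x part avoiding L. If v is not a 3-target of u, no weight
-- changes. Otherwise v itself gains p^(3-d), d its level, and a vertex x can only lose weight
-- through paths u ⇝ v ⇝ x. With N = Target¹_L(v) ∖ {u}, the loss is at most |N| when d = 2, and
-- then N with the path v w u is a packing at v, so |N| < p. When d = 1 the loss is at most
-- p|N| + |N₂|, N₂ the vertices first reached from v at level 2; a greedy matching M of paths
-- v y x covering N₂ gives a packing {v u} ∪ N ∪ M, so 1 + |N| + |M| ≤ p, while each middle
-- vertex y lies in R and so covers at most p vertices: |N₂| ≤ p|M| and the loss is below p².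

open import Defs
open import Data.Bool using (if_then_else_)
open import Data.Fin using (Fin; _≟_)
open import Data.Fin.Subset using (Subset; _∈_; _∉_; _⊆_; _∪_; ⁅_⁆)
open import Data.Fin.Subset.Properties using (p⊆p∪q; q⊆p∪q; x∈p∪q⁻; x∈⁅x⁆; x∈⁅y⁆⇒x≡y)
open import Data.List using (List; []; _∷_; _++_; [_]; map; length; filter; allFin; concatMap)
open import Data.List.Membership.Propositional using () renaming (_∈_ to _∈ₗ_)
open import Data.List.Membership.Propositional.Properties using (∈-++⁺ʳ; ∈-++⁻; ∈-allFin; ∈-filter⁻)
open import Data.List.Properties using (++-identityʳ; ++-assoc; length-map; length-++)
open import Data.List.Relation.Binary.Disjoint.Propositional using (Disjoint)
open import Data.List.Relation.Unary.All as All using (All; []; _∷_)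
import Data.List.Relation.Unary.All.Properties as All
open import Data.List.Relation.Unary.All.Properties using (all-filter)
open import Data.List.Relation.Unary.AllPairs using ([]; _∷_)
open import Data.List.Relation.Unary.Any using (Any; here; there; any?)
open import Data.List.Relation.Unary.Linked using ([]; [-]; _∷_)
open import Data.List.Relation.Unary.Unique.Propositional using (Unique)
import Data.List.Relation.Unary.Unique.Propositional.Properties as Unique
open import Data.Nat using (ℕ; suc; _+_; _*_; _≤_; _<_; z≤n; s≤s; >-nonZero)
open import Data.Nat.ListAction using (sum)
open import Data.Nat.Properties hiding (_≟_)
open import Algebra.Properties.CommutativeSemigroup +-commutativeSemigroup using (interchange; xy∙z≈xz∙y)
open import Data.Product using (Σ; _×_; _,_; proj₁; proj₂)
open import Data.Sum using (_⊎_; inj₁; inj₂)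
open import Function using (_∘_; _⇔_; Equivalence; mk⇔)
open import Relation.Binary.PropositionalEquality hiding ([_])
open import Relation.Nullary using (¬_; Dec; does; yes; no; _×-dec_; _⊎-dec_; ¬?; contradiction)
open import Relation.Unary using (Decidable)

sum-map-const-0 : {A : Set} (xs : List A) → sum (map (λ _ → 0) xs) ≡ 0
sum-map-const-0 []       = refl
sum-map-const-0 (_ ∷ xs) = sum-map-const-0 xs

module _ {A : Set} where

  sum-map-+ : (f g : A → ℕ) (xs : List A) →
              sum (map (λ x → f x + g x) xs) ≡ sum (map f xs) + sum (map g xs)
  sum-map-+ f g []       = refl
  sum-map-+ f g (x ∷ xs) = trans (cong (f x + g x +_) (sum-map-+ f g xs)) (interchange (f x) (g x) _ _)

  sum-map-*ʳ : (f : A → ℕ) (c : ℕ) (xs : List A) →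
               sum (map (λ x → f x * c) xs) ≡ sum (map f xs) * c
  sum-map-*ʳ f c []       = refl
  sum-map-*ʳ f c (x ∷ xs) = trans (cong (f x * c +_) (sum-map-*ʳ f c xs)) (sym (*-distribʳ-+ c (f x) _))

  sum-map-cong : {f g : A → ℕ} → (∀ x → f x ≡ g x) → ∀ xs → sum (map f xs) ≡ sum (map g xs)
  sum-map-cong f≗g []       = refl
  sum-map-cong f≗g (x ∷ xs) = cong₂ _+_ (f≗g x) (sum-map-cong f≗g xs)

  sum-map-mono : {f g : A → ℕ} → (∀ x → f x ≤ g x) → ∀ xs → sum (map f xs) ≤ sum (map g xs)
  sum-map-mono f≤g []       = z≤n
  sum-map-mono f≤g (x ∷ xs) = +-mono-≤ (f≤g x) (sum-map-mono f≤g xs)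

  sum-map-≤-length* : {f : A → ℕ} {c : ℕ} {xs : List A} →
                      All (λ x → f x ≤ c) xs → sum (map f xs) ≤ length xs * c
  sum-map-≤-length* []           = z≤n
  sum-map-≤-length* (fx≤c ∷ f≤c) = +-mono-≤ fx≤c (sum-map-≤-length* f≤c)

  sum-map-<-compensated : {f g h : A → ℕ} {c : ℕ} {v : A} {xs : List A} →
                          (∀ x → f x ≤ g x + h x) → v ∈ₗ xs → f v + c ≤ g v →
                          sum (map h xs) < c → sum (map f xs) < sum (map g xs)
  sum-map-<-compensated {f} {g} {h} {c} {v} {xs} f≤g+h v∈xs gain loss<c =
    +-cancelʳ-< c _ _ (begin-strict
      sum (map f xs) + c                  ≤⟨ slack v∈xs ⟩
      sum (map (λ x → g x + h x) xs)      ≡⟨ sum-map-+ g h xs ⟩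
      sum (map g xs) + sum (map h xs)     <⟨ +-monoʳ-< (sum (map g xs)) loss<c ⟩
      sum (map g xs) + c                  ∎)
    where
    open ≤-Reasoning
    slack : ∀ {ys} → v ∈ₗ ys → sum (map f ys) + c ≤ sum (map (λ x → g x + h x) ys)
    slack {y ∷ ys} (here refl) = begin
      f y + sum (map f ys) + c   ≡⟨ xy∙z≈xz∙y (f y) _ c ⟩
      (f y + c) + sum (map f ys) ≤⟨ +-mono-≤ (≤-trans gain (m≤m+n (g y) (h y))) (sum-map-mono f≤g+h ys) ⟩
      _ ∎
    slack {y ∷ ys} (there v∈ys) = begin
      f y + sum (map f ys) + c   ≡⟨ +-assoc (f y) _ c ⟩
      f y + (sum (map f ys) + c) ≤⟨ +-mono-≤ (f≤g+h y) (slack v∈ys) ⟩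
      _ ∎

sum-map-swap : {A B : Set} (f : A → B → ℕ) (xs : List A) (ys : List B) →
               sum (map (λ x → sum (map (f x) ys)) xs) ≡ sum (map (λ y → sum (map (λ x → f x y) xs)) ys)
sum-map-swap f []       ys = sym (sum-map-const-0 ys)
sum-map-swap f (x ∷ xs) ys = trans (cong (sum (map (f x) ys) +_) (sum-map-swap f xs ys))
                                   (sym (sum-map-+ (f x) (λ y → sum (map (λ x → f x y) xs)) ys))

indicator : {P : Set} → Dec P → ℕ
indicator P? = if does P? then 1 else 0

indicator-yes : {P : Set} (P? : Dec P) → P → indicator P? ≡ 1
indicator-yes (yes _) _  = refl
indicator-yes (no ¬p) p = contradiction p ¬p

indicator-≤ : {P : Set} (P? : Dec P) {V : ℕ} → (P → 1 ≤ V) → indicator P? ≤ V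
indicator-≤ (yes p) h = h p
indicator-≤ (no _)  _ = z≤n

module _ {A : Set} {P : A → Set} (P? : Decidable P) where

  length-filter≡sum-indicator : ∀ xs → length (filter P? xs) ≡ sum (map (λ x → indicator (P? x)) xs)
  length-filter≡sum-indicator []       = refl
  length-filter≡sum-indicator (x ∷ xs) with P? x
  ... | yes _ = cong suc (length-filter≡sum-indicator xs)
  ... | no  _ = length-filter≡sum-indicator xs

  sum-indicator-any : ∀ {xs} → Any P xs → 1 ≤ sum (map (λ x → indicator (P? x)) xs)
  sum-indicator-any {x ∷ xs} (here px) = ≤-trans (≤-reflexive (sym (indicator-yes (P? x) px))) (m≤m+n _ _)
  sum-indicator-any {x ∷ xs} (there pxs) = ≤-trans (sum-indicator-any pxs) (m≤n+m _ _)

-- The summand of φ at a vertex x, with A, B, C read as x ∈ Target¹, x ∈ Target², x ∈ Target³.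
weight : {A B C : Set} → ℕ → Dec A → Dec B → Dec C → ℕ
weight p A? B? C? =
    indicator A? * (p * p)
  + indicator (B? ×-dec ¬? A?) * p
  + indicator (C? ×-dec ¬? (A? ⊎-dec (B? ×-dec ¬? A?)))

module _ {A B C : Set} (p : ℕ) where

  private
    m+0+0+0≡m : ∀ m → m + 0 + 0 + 0 ≡ m
    m+0+0+0≡m m = trans (+-identityʳ _) (trans (+-identityʳ _) (+-identityʳ m))

  weight≡p² : (A? : Dec A) (B? : Dec B) (C? : Dec C) → A → weight p A? B? C? ≡ p * p
  weight≡p² (yes _) (yes _) (yes _) _ = m+0+0+0≡m (p * p)
  weight≡p² (yes _) (yes _) (no _)  _ = m+0+0+0≡m (p * p)
  weight≡p² (yes _) (no _)  (yes _) _ = m+0+0+0≡m (p * p)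
  weight≡p² (yes _) (no _)  (no _)  _ = m+0+0+0≡m (p * p)
  weight≡p² (no ¬a) _       _       a = contradiction a ¬a

  weight≡p : (A? : Dec A) (B? : Dec B) (C? : Dec C) → ¬ A → B → weight p A? B? C? ≡ p
  weight≡p (yes a) _       _       ¬a _ = contradiction a ¬a
  weight≡p (no _)  (yes _) (yes _) _  _ = trans (+-identityʳ _) (+-identityʳ p)
  weight≡p (no _)  (yes _) (no _)  _  _ = trans (+-identityʳ _) (+-identityʳ p)
  weight≡p (no _)  (no ¬b) _       _  b = contradiction b ¬b

  weight≡1 : (A? : Dec A) (B? : Dec B) (C? : Dec C) → ¬ A → ¬ B → C → weight p A? B? C? ≡ 1
  weight≡1 (yes a) _       _       ¬a _  _ = contradiction a ¬a
  weight≡1 (no _)  (yes b) _       _  ¬b _ = contradiction b ¬b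
  weight≡1 (no _)  (no _)  (yes _) _  _  _ = refl
  weight≡1 (no _)  (no _)  (no ¬c) _  _  c = contradiction c ¬c

  weight-≤ : (A? : Dec A) (B? : Dec B) (C? : Dec C) {V : ℕ} →
             (A → p * p ≤ V) → (B → p ≤ V) → (C → 1 ≤ V) → weight p A? B? C? ≤ V
  weight-≤ (yes a) B?      C?      h₁ _  _  = ≤-trans (≤-reflexive (weight≡p² (yes a) B? C? a)) (h₁ a)
  weight-≤ (no ¬a) (yes b) C?      _  h₂ _  = ≤-trans (≤-reflexive (weight≡p (no ¬a) (yes b) C? ¬a b)) (h₂ b)
  weight-≤ (no ¬a) (no ¬b) (yes c) _  _  h₃ = h₃ c
  weight-≤ (no _)  (no _)  (no _)  _  _  _  = z≤n

  module _ (1≤p : 1 ≤ p) where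

    p≤p² : p ≤ p * p
    p≤p² = m≤m*n p p {{>-nonZero 1≤p}}

    weight-≥p² : (A? : Dec A) (B? : Dec B) (C? : Dec C) → A → p * p ≤ weight p A? B? C?
    weight-≥p² A? B? C? a = ≤-reflexive (sym (weight≡p² A? B? C? a))

    weight-≥p : (A? : Dec A) (B? : Dec B) (C? : Dec C) → B → p ≤ weight p A? B? C?
    weight-≥p (yes a) B? C? _ = ≤-trans p≤p² (weight-≥p² (yes a) B? C? a)
    weight-≥p (no ¬a) B? C? b = ≤-reflexive (sym (weight≡p (no ¬a) B? C? ¬a b))

    weight-≥1 : (A? : Dec A) (B? : Dec B) (C? : Dec C) → C → 1 ≤ weight p A? B? C?
    weight-≥1 (yes a) B?      C? _ = ≤-trans (≤-trans 1≤p p≤p²) (weight-≥p² (yes a) B? C? a)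
    weight-≥1 (no ¬a) (yes b) C? _ = ≤-trans 1≤p (weight-≥p (no ¬a) (yes b) C? b)
    weight-≥1 (no ¬a) (no ¬b) C? c = ≤-reflexive (sym (weight≡1 (no ¬a) (no ¬b) C? ¬a ¬b c))

weight-cong : {A B C A′ B′ C′ : Set} {p : ℕ} → 1 ≤ p →
              (A? : Dec A) (B? : Dec B) (C? : Dec C) (A′? : Dec A′) (B′? : Dec B′) (C′? : Dec C′) →
              A ⇔ A′ → B ⇔ B′ → C ⇔ C′ → weight p A? B? C? ≡ weight p A′? B′? C′?
weight-cong {p = p} 1≤p A? B? C? A′? B′? C′? A⇔A′ B⇔B′ C⇔C′ = ≤-antisym
  (weight-≤ p A? B? C? (weight-≥p² p 1≤p A′? B′? C′? ∘ to A⇔A′) (weight-≥p p 1≤p A′? B′? C′? ∘ to B⇔B′)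
                       (weight-≥1 p 1≤p A′? B′? C′? ∘ to C⇔C′))
  (weight-≤ p A′? B′? C′? (weight-≥p² p 1≤p A? B? C? ∘ from A⇔A′) (weight-≥p p 1≤p A? B? C? ∘ from B⇔B′)
                          (weight-≥1 p 1≤p A? B? C? ∘ from C⇔C′))
  where open Equivalence

module _ {n : ℕ} (G : Graph n) where
  open Graph G renaming (sym to Adj-sym)

  path₁ : ∀ {a x} → a ≢ x → Adj a x → IsPath G a [] x
  path₁ a≢x ax = (ax ∷ [-]) , ((a≢x ∷ []) ∷ [] ∷ [])

  path₂ : ∀ {a b x} → a ≢ b → a ≢ x → b ≢ x → Adj a b → Adj b x → IsPath G a [ b ] x
  path₂ a≢b a≢x b≢x ab bx = (ab ∷ bx ∷ [-]) , ((a≢b ∷ a≢x ∷ []) ∷ (b≢x ∷ []) ∷ [] ∷ [])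

  Target-mono : ∀ {r r′ Y a x} → r ≤ r′ → Target G r Y a x → Target G r′ Y a x
  Target-mono r≤r′ (x∈Y , x≢a , inner , path , len , avoid) = x∈Y , x≢a , inner , path , ≤-trans len r≤r′ , avoid

  Target-⊆ : ∀ {r Y Z a x} → Y ⊆ Z → x ∈ Y → Target G r Z a x → Target G r Y a x
  Target-⊆ Y⊆Z x∈Y (_ , x≢a , inner , path , len , avoid) =
    x∈Y , x≢a , inner , path , len , All.map (λ w∉Z w∈Y → w∉Z (Y⊆Z w∈Y)) avoid

  Target₁⇒Adj : ∀ {Y a x} → Target G 1 Y a x → Adj a x
  Target₁⇒Adj (_ , _ , [] , ((ax ∷ [-]) , _) , _ , _) = ax
  Target₁⇒Adj (_ , _ , _ ∷ _ , _ , s≤s () , _)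

  Adj⇒Target₁ : ∀ {Y a x} → a ∉ Y → x ∈ Y → Adj a x → Target G 1 Y a x
  Adj⇒Target₁ a∉Y x∈Y ax = x∈Y , x≢a , [] , path₁ (x≢a ∘ sym) ax , s≤s z≤n , []
    where
    x≢a : _ ≢ _
    x≢a refl = a∉Y x∈Y

  Target₂⇒middle : ∀ {Y a x} → ¬ Target G 1 Y a x → Target G 2 Y a x → Σ (Fin n) λ b → b ∉ Y × IsPath G a [ b ] x
  Target₂⇒middle ¬t₁ (x∈Y , x≢a , [] , path , _ , []) = contradiction (x∈Y , x≢a , [] , path , s≤s z≤n , []) ¬t₁
  Target₂⇒middle _   (_ , _ , b ∷ [] , path , _ , b∉Y ∷ []) = b , b∉Y , path
  Target₂⇒middle _   (_ , _ , _ ∷ _ ∷ _ , _ , s≤s (s≤s ()) , _)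

  reverse₂ : ∀ {a b x} → IsPath G a [ b ] x → IsPath G x [ b ] a
  reverse₂ ((ab ∷ bx ∷ [-]) , ((a≢b ∷ a≢x ∷ []) ∷ (b≢x ∷ []) ∷ [] ∷ [])) =
    path₂ (≢-sym b≢x) (≢-sym a≢x) (≢-sym a≢b) (Adj-sym bx) (Adj-sym ab)

  Entry : Set
  Entry = List (Fin n) × Fin n

  pathVertices : List Entry → List (Fin n)
  pathVertices = concatMap (λ q → proj₁ q ++ [ proj₂ q ])

  pathVertices-++ : ∀ ps qs → pathVertices (ps ++ qs) ≡ pathVertices ps ++ pathVertices qs
  pathVertices-++ []       qs = refl
  pathVertices-++ (q ∷ ps) qs =
    trans (cong ((proj₁ q ++ [ proj₂ q ]) ++_) (pathVertices-++ ps qs))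
          (sym (++-assoc (proj₁ q ++ [ proj₂ q ]) _ _))

  Admissible⇒Target : ∀ {r Y a inner x} → x ∈ Y → Admissible G r Y a inner x → Target G r Y a x
  Admissible⇒Target {inner = inner} x∈Y adm@((_ , a∉rest ∷ _) , _) =
    x∈Y , (λ x≡a → All.lookup a∉rest (∈-++⁺ʳ inner (here (sym x≡a))) refl) , inner , adm

  IsPacking-[_] : ∀ {r Y a inner x} → x ∈ Y → Admissible G r Y a inner x → IsPacking G r Y a [ (inner , x) ]
  IsPacking-[_] x∈Y adm@((_ , _ ∷ unique) , _) =
    (adm , Admissible⇒Target x∈Y adm) ∷ [] , subst Unique (sym (++-identityʳ _)) unique

  IsPacking-++ : ∀ {r Y a ps qs} → IsPacking G r Y a ps → IsPacking G r Y a qs →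
                 Disjoint (pathVertices ps) (pathVertices qs) → IsPacking G r Y a (ps ++ qs)
  IsPacking-++ {ps = ps} {qs} (adm₁ , unique₁) (adm₂ , unique₂) disjoint =
    All.++⁺ adm₁ adm₂ , subst Unique (sym (pathVertices-++ ps qs)) (Unique.++⁺ unique₁ unique₂ disjoint)

  edges : List (Fin n) → List Entry
  edges = map ([] ,_)

  pathVertices-edges : ∀ xs → pathVertices (edges xs) ≡ xs
  pathVertices-edges []       = refl
  pathVertices-edges (x ∷ xs) = cong (x ∷_) (pathVertices-edges xs)

  Target₁⇒Admissible : ∀ {r Y a x} → 1 ≤ r → Target G 1 Y a x → Admissible G r Y a [] x
  Target₁⇒Admissible 1≤r (_ , _ , [] , path , _ , avoid) = path , 1≤r , avoid
  Target₁⇒Admissible 1≤r (_ , _ , _ ∷ _ , _ , s≤s () , _)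

  IsPacking-edges : ∀ {r Y a xs} → 1 ≤ r → Unique xs → All (Target G 1 Y a) xs → IsPacking G r Y a (edges xs)
  IsPacking-edges {xs = xs} 1≤r unique targets =
    All.map⁺ (All.map (λ t → Target₁⇒Admissible 1≤r t , Target-mono 1≤r t) targets) ,
    subst Unique (sym (pathVertices-edges xs)) unique

  module _ (dT : TargetDecider G) (p : ℕ) (X : Subset n) (u : Fin n) where

    targetWeight : Fin n → ℕ
    targetWeight x = weight p (dT 1 X u x) (dT 2 X u x) (dT 3 X u x)

    φ≡sum-targetWeight : φ G dT p X u ≡ sum (map targetWeight (allFin n))
    φ≡sum-targetWeight = sym (begin
      sum (map targetWeight xs)                                     ≡⟨ sum-map-+ (λ x → w₁ x + w₂ x) w₃ xs ⟩
      sum (map (λ x → w₁ x + w₂ x) xs) + sum (map w₃ xs)            ≡⟨ cong (_+ sum (map w₃ xs)) (sum-map-+ w₁ w₂ xs) ⟩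
      sum (map w₁ xs) + sum (map w₂ xs) + sum (map w₃ xs)           ≡⟨ cong₂ (λ s t → s + t + sum (map w₃ xs))
                                                                         (sum-map-*ʳ _ (p * p) xs) (sum-map-*ʳ _ p xs) ⟩
      φ G dT p X u                                                  ∎)
      where
      open ≡-Reasoning
      xs : List (Fin n)
      xs = allFin n
      w₁ w₂ w₃ : Fin n → ℕ
      w₁ x = indicator (dT 1 X u x) * (p * p)
      w₂ x = indicator (dT 2 X u x ×-dec ¬? (dT 1 X u x)) * p
      w₃ x = indicator (dT 3 X u x ×-dec ¬? (dT 1 X u x ⊎-dec (dT 2 X u x ×-dec ¬? (dT 1 X u x))))

  module _ (L : Subset n) (v : Fin n) where

    ∈-∪⁅v⁆ : ∀ {x} → x ∈ L → x ∈ L ∪ ⁅ v ⁆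
    ∈-∪⁅v⁆ = p⊆p∪q ⁅ v ⁆

    v∈-∪⁅v⁆ : v ∈ L ∪ ⁅ v ⁆
    v∈-∪⁅v⁆ = q⊆p∪q L ⁅ v ⁆ (x∈⁅x⁆ v)

    ∉-∪⁅v⁆ : ∀ {a} → a ∉ L → a ≢ v → a ∉ L ∪ ⁅ v ⁆
    ∉-∪⁅v⁆ a∉L a≢v a∈L⁺ with x∈p∪q⁻ L ⁅ v ⁆ a∈L⁺
    ... | inj₁ a∈L = a∉L a∈L
    ... | inj₂ a∈⁅v⁆ = a≢v (x∈⁅y⁆⇒x≡y v a∈⁅v⁆)

    ∈-∪⁅v⁆⁻ : ∀ {a} → a ∈ L ∪ ⁅ v ⁆ → a ≢ v → a ∈ L
    ∈-∪⁅v⁆⁻ a∈L⁺ a≢v with x∈p∪q⁻ L ⁅ v ⁆ a∈L⁺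
    ... | inj₁ a∈L = a∈L
    ... | inj₂ a∈⁅v⁆ = contradiction (x∈⁅y⁆⇒x≡y v a∈⁅v⁆) a≢v

    module _ (u : Fin n) where

      data Route (r : ℕ) (x : Fin n) : Set where
        avoids-v : Target G r (L ∪ ⁅ v ⁆) u x → Route r x
        via-v₁₁  : Target G 1 (L ∪ ⁅ v ⁆) u v → Target G 1 L v x → 2 ≤ r → Route r x
        via-v₁₂  : Target G 1 (L ∪ ⁅ v ⁆) u v → Target G 2 L v x → 3 ≤ r → Route r x
        via-v₂₁  : Target G 2 (L ∪ ⁅ v ⁆) u v → Target G 1 L v x → 3 ≤ r → Route r x

      route : ∀ {r x} → r ≤ 3 → Target G r L u x → Route r x
      route _ (x∈L , x≢u , [] , path , len , []) = avoids-v (∈-∪⁅v⁆ x∈L , x≢u , [] , path , len , [])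
      route _ (x∈L , x≢u , a ∷ [] , path@((ua ∷ ax ∷ [-]) , ((u≢a ∷ _) ∷ (a≢x ∷ []) ∷ _)) , len , a∉L ∷ [])
        with a ≟ v
      ... | yes refl = via-v₁₁ (v∈-∪⁅v⁆ , ≢-sym u≢a , [] , path₁ u≢a ua , ≤-refl , [])
                               (x∈L , ≢-sym a≢x , [] , path₁ a≢x ax , ≤-refl , []) len
      ... | no a≢v   = avoids-v (∈-∪⁅v⁆ x∈L , x≢u , [ a ] , path , len , ∉-∪⁅v⁆ a∉L a≢v ∷ [])
      route _ (x∈L , x≢u , a ∷ b ∷ [] ,
               path@((ua ∷ ab ∷ bx ∷ [-]) , ((u≢a ∷ u≢b ∷ _) ∷ (a≢b ∷ a≢x ∷ []) ∷ (b≢x ∷ []) ∷ _)) ,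
               len , a∉L ∷ b∉L ∷ [])
        with a ≟ v | b ≟ v
      ... | yes refl | _        = via-v₁₂ (v∈-∪⁅v⁆ , ≢-sym u≢a , [] , path₁ u≢a ua , ≤-refl , [])
                                          (x∈L , ≢-sym a≢x , [ b ] , path₂ a≢b a≢x b≢x ab bx , ≤-refl , b∉L ∷ []) len
      ... | no a≢v   | yes refl = via-v₂₁ (v∈-∪⁅v⁆ , ≢-sym u≢b , [ a ] , path₂ u≢a u≢b a≢b ua ab , ≤-refl ,
                                            ∉-∪⁅v⁆ a∉L a≢v ∷ [])
                                          (x∈L , ≢-sym b≢x , [] , path₁ b≢x bx , ≤-refl , []) len
      ... | no a≢v   | no b≢v   = avoids-v (∈-∪⁅v⁆ x∈L , x≢u , a ∷ b ∷ [] , path , len ,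
                                            ∉-∪⁅v⁆ a∉L a≢v ∷ ∉-∪⁅v⁆ b∉L b≢v ∷ [])
      route r≤3 (_ , _ , _ ∷ _ ∷ _ ∷ _ , _ , len , _) with ≤-trans len r≤3
      ... | s≤s (s≤s (s≤s ()))

module GreedyMatching {A : Set} (Edge Cover : A → A → Set) (Cover? : ∀ y x → Dec (Cover y x))
  (Edge⇒Cover : ∀ {y x} → Edge y x → Cover y x)
  (source≢target : ∀ {y x y′ x′} → Edge y x → Edge y′ x′ → y ≢ x′)
  {B : A → Set} (B? : Decidable B) (edgeInto : ∀ {x} → B x → Σ A λ y → Edge y x) where

  ends : List (A × A) → List A
  ends []            = []
  ends ((y , x) ∷ M) = y ∷ x ∷ ends M

  Covered : List (A × A) → A → Set
  Covered M x = Any (λ e → Cover (proj₁ e) x) M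

  ValidEdge : A × A → Set
  ValidEdge (y , x) = Edge y x × B x

  ends-All : ∀ {P : A → Set} {M} → (∀ {y x} → Edge y x → P y) → (∀ {x} → B x → P x) →
             All ValidEdge M → All P (ends M)
  ends-All P-source P-target []                 = []
  ends-All P-source P-target ((yx , bx) ∷ valid) = P-source yx ∷ P-target bx ∷ ends-All P-source P-target valid

  source-covered : ∀ {M z x} → All ValidEdge M → z ∈ₗ ends M → Edge z x → Covered M x
  source-covered {_ ∷ _} (_ ∷ _)         (here refl)          zx = here (Edge⇒Cover zx)
  source-covered {_ ∷ _} ((yx , _) ∷ _)  (there (here refl))  zx = contradiction refl (source≢target zx yx)
  source-covered {_ ∷ _} (_ ∷ valid)     (there (there z∈M))  zx = there (source-covered valid z∈M zx)

  target-covered : ∀ {M y x} → All ValidEdge M → x ∈ₗ ends M → Edge y x → Covered M x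
  target-covered {_ ∷ _} ((y′x′ , _) ∷ _) (here refl)          yx = contradiction refl (source≢target y′x′ yx)
  target-covered {_ ∷ _} ((y′x′ , _) ∷ _) (there (here refl))  _  = here (Edge⇒Cover y′x′)
  target-covered {_ ∷ _} (_ ∷ valid)      (there (there x∈M))  yx = there (target-covered valid x∈M yx)

  record Matching (xs : List A) : Set where
    field
      pairs  : List (A × A)
      valid  : All ValidEdge pairs
      unique : Unique (ends pairs)
      covers : ∀ {x} → x ∈ₗ xs → B x → Covered pairs x

  keep : ∀ {x xs} (m : Matching xs) → (B x → Covered (Matching.pairs m) x) → Matching (x ∷ xs)
  keep m covered = record
    { pairs = pairs ; valid = valid ; unique = unique
    ; covers = λ { (here refl) → covered ; (there x∈xs) → covers x∈xs } }
    where open Matching m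

  extend : ∀ {x xs} (m : Matching xs) → B x → ¬ Covered (Matching.pairs m) x → Matching (x ∷ xs)
  extend {x} m bx uncovered = record
    { pairs  = (y , x) ∷ pairs
    ; valid  = (yx , bx) ∷ valid
    ; unique = All.tabulate y-fresh ∷ All.tabulate x-fresh ∷ unique
    ; covers = λ { (here refl) _ → here (Edge⇒Cover yx) ; (there x∈xs) → there ∘ covers x∈xs } }
    where
    open Matching m
    y : A
    y = proj₁ (edgeInto bx)
    yx : Edge y x
    yx = proj₂ (edgeInto bx)
    y-fresh : ∀ {z} → z ∈ₗ x ∷ ends pairs → y ≢ z
    y-fresh (here refl)  = source≢target yx yx
    y-fresh (there z∈M) refl = uncovered (source-covered valid z∈M yx)
    x-fresh : ∀ {z} → z ∈ₗ ends pairs → x ≢ z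
    x-fresh x∈M refl = uncovered (target-covered valid x∈M yx)

  greedy : ∀ xs → Matching xs
  greedy []       = record { pairs = [] ; valid = [] ; unique = [] ; covers = λ () }
  greedy (x ∷ xs) with greedy xs | B? x
  ... | m | no ¬bx = keep m (λ bx → contradiction bx ¬bx)
  ... | m | yes bx with any? (λ e → Cover? (proj₁ e) x) (Matching.pairs m)
  ...   | yes covered   = keep m (λ _ → covered)
  ...   | no  uncovered = extend m bx uncovered

module Potential {n} (G : Graph n) (p : ℕ) (1≤p : 1 ≤ p) (L R : Subset n)
  (L∪R : ∀ x → x ∈ L ⊎ x ∈ R) (L∩R : ∀ x → x ∈ L → x ∉ R)
  (pp≤p : ∀ x → x ∈ R → ppAtMost G 3 L x p)
  (v : Fin n) (v∈R : v ∈ R) (dT : TargetDecider G) (u : Fin n) (u∈L : u ∈ L) where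

  open Graph G renaming (sym to Adj-sym)

  L⁺ : Subset n
  L⁺ = L ∪ ⁅ v ⁆

  v∉L : v ∉ L
  v∉L v∈L = L∩R v v∈L v∈R

  ∉L⇒∈R : ∀ {y} → y ∉ L → y ∈ R
  ∉L⇒∈R {y} y∉L with L∪R y
  ... | inj₁ y∈L = contradiction y∈L y∉L
  ... | inj₂ y∈R = y∈R

  ∈-∉-≢ : ∀ {a b} → a ∈ L → b ∉ L → a ≢ b
  ∈-∉-≢ a∈L b∉L refl = b∉L a∈L

  w : Subset n → Fin n → ℕ
  w Y = targetWeight G dT p Y u

  module _ {Y : Subset n} {x : Fin n} where

    w-≤ : ∀ {V} → (Target G 1 Y u x → p * p ≤ V) → (Target G 2 Y u x → p ≤ V) → (Target G 3 Y u x → 1 ≤ V) →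
          w Y x ≤ V
    w-≤ = weight-≤ p (dT 1 Y u x) (dT 2 Y u x) (dT 3 Y u x)

    w-≥p² : Target G 1 Y u x → p * p ≤ w Y x
    w-≥p² = weight-≥p² p 1≤p (dT 1 Y u x) (dT 2 Y u x) (dT 3 Y u x)

    w-≥p : Target G 2 Y u x → p ≤ w Y x
    w-≥p = weight-≥p p 1≤p (dT 1 Y u x) (dT 2 Y u x) (dT 3 Y u x)

    w-≥1 : Target G 3 Y u x → 1 ≤ w Y x
    w-≥1 = weight-≥1 p 1≤p (dT 1 Y u x) (dT 2 Y u x) (dT 3 Y u x)

  module Unreachable (v-unreachable : ¬ Target G 3 L⁺ u v) where

    Target-L⁺⇔L : ∀ {r x} → r ≤ 3 → Target G r L⁺ u x ⇔ Target G r L u x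
    Target-L⁺⇔L {r} {x} r≤3 = mk⇔ to from
      where
      to : Target G r L⁺ u x → Target G r L u x
      to t with x ≟ v
      ... | yes refl = contradiction (Target-mono G r≤3 t) v-unreachable
      ... | no x≢v   = Target-⊆ G (p⊆p∪q ⁅ v ⁆) (∈-∪⁅v⁆⁻ G L v (proj₁ t) x≢v) t
      from : Target G r L u x → Target G r L⁺ u x
      from t with route G L v u r≤3 t
      ... | avoids-v t′    = t′
      ... | via-v₁₁ t′ _ _ = contradiction (Target-mono G (s≤s z≤n) t′) v-unreachable
      ... | via-v₁₂ t′ _ _ = contradiction (Target-mono G (s≤s z≤n) t′) v-unreachable
      ... | via-v₂₁ t′ _ _ = contradiction (Target-mono G (s≤s (s≤s z≤n)) t′) v-unreachable

    φ-unchanged : φ G dT p L⁺ u ≡ φ G dT p L u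
    φ-unchanged = begin
      φ G dT p L⁺ u                ≡⟨ φ≡sum-targetWeight G dT p L⁺ u ⟩
      sum (map (w L⁺) (allFin n))  ≡⟨ sum-map-cong w-L⁺≡w-L (allFin n) ⟩
      sum (map (w L) (allFin n))   ≡⟨ φ≡sum-targetWeight G dT p L u ⟨
      φ G dT p L u                 ∎
      where
      open ≡-Reasoning
      w-L⁺≡w-L : ∀ x → w L⁺ x ≡ w L x
      w-L⁺≡w-L x = weight-cong 1≤p (dT 1 L⁺ u x) (dT 2 L⁺ u x) (dT 3 L⁺ u x) (dT 1 L u x) (dT 2 L u x) (dT 3 L u x)
        (Target-L⁺⇔L (s≤s z≤n)) (Target-L⁺⇔L (s≤s (s≤s z≤n))) (Target-L⁺⇔L ≤-refl)

  w-loss : (loss : Fin n → ℕ) →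
           (∀ {x} → Target G 1 L⁺ u v → Target G 1 L v x → x ≢ u → p ≤ loss x) →
           (∀ {x} → Target G 1 L⁺ u v → Target G 2 L v x → x ≢ u → 1 ≤ loss x) →
           (∀ {x} → Target G 2 L⁺ u v → Target G 1 L v x → x ≢ u → 1 ≤ loss x) →
           ∀ x → w L x ≤ w L⁺ x + loss x
  w-loss loss loss₁₁ loss₁₂ loss₂₁ x = w-≤ level₁ level₂ level₃
    where
    kept : ∀ {k V} → k ≤ w L⁺ x → k ≤ w L⁺ x + V
    kept k≤w = ≤-trans k≤w (m≤m+n _ _)
    lost : ∀ {k} → k ≤ loss x → k ≤ w L⁺ x + loss x
    lost k≤loss = ≤-trans k≤loss (m≤n+m _ _)
    level₁ : Target G 1 L u x → p * p ≤ w L⁺ x + loss x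
    level₁ t with route G L v u (s≤s z≤n) t
    ... | avoids-v t′ = kept (w-≥p² t′)
    ... | via-v₁₁ _ _ (s≤s ())
    ... | via-v₁₂ _ _ (s≤s ())
    ... | via-v₂₁ _ _ (s≤s ())
    level₂ : Target G 2 L u x → p ≤ w L⁺ x + loss x
    level₂ t with route G L v u (s≤s (s≤s z≤n)) t
    ... | avoids-v t′      = kept (w-≥p t′)
    ... | via-v₁₁ uv vx _  = lost (loss₁₁ uv vx (proj₁ (proj₂ t)))
    ... | via-v₁₂ _ _ (s≤s (s≤s ()))
    ... | via-v₂₁ _ _ (s≤s (s≤s ()))
    level₃ : Target G 3 L u x → 1 ≤ w L⁺ x + loss x
    level₃ t with route G L v u ≤-refl t
    ... | avoids-v t′      = kept (w-≥1 t′)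
    ... | via-v₁₁ uv vx _  = lost (≤-trans 1≤p (loss₁₁ uv vx (proj₁ (proj₂ t))))
    ... | via-v₁₂ uv vx _  = lost (loss₁₂ uv vx (proj₁ (proj₂ t)))
    ... | via-v₂₁ uv vx _  = lost (loss₂₁ uv vx (proj₁ (proj₂ t)))

  φ-increase : (loss : Fin n → ℕ) {c : ℕ} → (∀ x → w L x ≤ w L⁺ x + loss x) → c ≤ w L⁺ v →
               sum (map loss (allFin n)) < c → φ G dT p L u < φ G dT p L⁺ u
  φ-increase loss {c} pointwise gain loss<c =
    subst₂ _<_ (sym (φ≡sum-targetWeight G dT p L u)) (sym (φ≡sum-targetWeight G dT p L⁺ u))
      (sum-map-<-compensated pointwise (∈-allFin v) (≤-trans (+-monoˡ-≤ c w-L-v≤0) gain) loss<c)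
    where
    v∉Target : ∀ {r} {V : Set} → Target G r L u v → V
    v∉Target (v∈L , _) = contradiction v∈L v∉L
    w-L-v≤0 : w L v ≤ 0
    w-L-v≤0 = w-≤ {L} {v} v∉Target v∉Target v∉Target

  count-Target₁≤p : ∀ {y} → y ∈ R → sum (map (λ x → indicator (dT 1 L y x)) (allFin n)) ≤ p
  count-Target₁≤p {y} y∈R =
    subst (_≤ p) (trans (length-map ([] ,_) targets) (length-filter≡sum-indicator (dT 1 L y) (allFin n)))
      (pp≤p y y∈R (edges G targets)
        (IsPacking-edges G (s≤s z≤n) (Unique.filter⁺ (dT 1 L y) (Unique.allFin⁺ n)) (all-filter (dT 1 L y) (allFin n))))
    where
    targets : List (Fin n)
    targets = filter (dT 1 L y) (allFin n)

  Nbr : Fin n → Set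
  Nbr x = x ≢ u × Target G 1 L v x

  Nbr? : Decidable Nbr
  Nbr? x = ¬? (x ≟ u) ×-dec dT 1 L v x

  nbrs : List (Fin n)
  nbrs = filter Nbr? (allFin n)

  #nbrs : ℕ
  #nbrs = sum (map (λ x → indicator (Nbr? x)) (allFin n))

  ∈-nbrs : ∀ {z} → z ∈ₗ pathVertices G (edges G nbrs) → Nbr z
  ∈-nbrs z∈ = proj₂ (∈-filter⁻ Nbr? {xs = allFin n} (subst (_ ∈ₗ_) (pathVertices-edges G nbrs) z∈))

  packing-bound : ∀ {inner} ps → Admissible G 3 L v inner u → IsPacking G 3 L v ps →
                  Disjoint inner (pathVertices G ps) → All (λ z → z ≢ u × ¬ Nbr z) (pathVertices G ps) →
                  suc (#nbrs + length ps) ≤ p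
  packing-bound {inner} ps adm packing disjoint fresh =
    subst (_≤ p) (cong suc (trans (length-++ (edges G nbrs)) (cong (_+ length ps) length-edges)))
      (pp≤p v v∈R ((inner , u) ∷ edges G nbrs ++ ps)
        (IsPacking-++ G (IsPacking-[_] G u∈L adm)
          (IsPacking-++ G (IsPacking-edges G (s≤s z≤n) (Unique.filter⁺ Nbr? (Unique.allFin⁺ n))
                                             (All.map proj₂ (all-filter Nbr? (allFin n))))
                          packing nbrs∩ps)
          path∩rest))
    where
    length-edges : length (edges G nbrs) ≡ #nbrs
    length-edges = trans (length-map ([] ,_) nbrs) (length-filter≡sum-indicator Nbr? (allFin n))
    nbrs∩ps : Disjoint (pathVertices G (edges G nbrs)) (pathVertices G ps)
    nbrs∩ps (z∈nbrs , z∈ps) = proj₂ (All.lookup fresh z∈ps) (∈-nbrs z∈nbrs)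
    path∩rest : Disjoint (pathVertices G [ (inner , u) ]) (pathVertices G (edges G nbrs ++ ps))
    path∩rest (z∈path , z∈rest)
      rewrite ++-identityʳ (inner ++ [ u ]) | pathVertices-++ G (edges G nbrs) ps
      with ∈-++⁻ inner z∈path | ∈-++⁻ (pathVertices G (edges G nbrs)) z∈rest
    ... | inj₁ z∈inner       | inj₁ z∈nbrs = All.lookup (proj₂ (proj₂ adm)) z∈inner (proj₁ (proj₂ (∈-nbrs z∈nbrs)))
    ... | inj₁ z∈inner       | inj₂ z∈ps   = disjoint (z∈inner , z∈ps)
    ... | inj₂ (here refl)   | inj₁ z∈nbrs = proj₁ (∈-nbrs z∈nbrs) refl
    ... | inj₂ (here refl)   | inj₂ z∈ps   = proj₁ (All.lookup fresh z∈ps) refl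

  φ-increase₃ : ¬ Target G 1 L⁺ u v → ¬ Target G 2 L⁺ u v → Target G 3 L⁺ u v → φ G dT p L u < φ G dT p L⁺ u
  φ-increase₃ ¬uv₁ ¬uv₂ uv₃ =
    φ-increase (λ _ → 0) (w-loss (λ _ → 0) (λ uv₁ → contradiction uv₁ ¬uv₁) (λ uv₁ → contradiction uv₁ ¬uv₁)
                                           (λ uv₂ → contradiction uv₂ ¬uv₂))
      (w-≥1 uv₃) (s≤s (≤-reflexive (sum-map-const-0 (allFin n))))

  φ-increase₂ : ¬ Target G 1 L⁺ u v → Target G 2 L⁺ u v → φ G dT p L u < φ G dT p L⁺ u
  φ-increase₂ ¬uv₁ uv₂ =
    φ-increase (λ x → indicator (Nbr? x))
      (w-loss _ (λ uv₁ → contradiction uv₁ ¬uv₁) (λ uv₁ → contradiction uv₁ ¬uv₁)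
                (λ {x} _ vx x≢u → ≤-reflexive (sym (indicator-yes (Nbr? x) (x≢u , vx)))))
      (w-≥p uv₂) #nbrs<p
    where
    #nbrs<p : #nbrs < p
    #nbrs<p with Target₂⇒middle G ¬uv₁ uv₂
    ... | m , m∉L⁺ , umv =
      ≤-trans (s≤s (≤-reflexive (sym (+-identityʳ #nbrs))))
        (packing-bound [] (reverse₂ G umv , s≤s (s≤s z≤n) , (m∉L⁺ ∘ ∈-∪⁅v⁆ G L v) ∷ []) ([] , []) (λ ()) [])

  Nbr₂ : Fin n → Set
  Nbr₂ x = x ≢ u × Target G 2 L v x × ¬ Target G 1 L v x

  Nbr₂? : Decidable Nbr₂
  Nbr₂? x = ¬? (x ≟ u) ×-dec (dT 2 L v x ×-dec ¬? (dT 1 L v x))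

  #nbrs₂ : ℕ
  #nbrs₂ = sum (map (λ x → indicator (Nbr₂? x)) (allFin n))

  Spoke : Fin n → Fin n → Set
  Spoke y x = y ∉ L × Adj v y × Target G 1 L y x

  spokeInto : ∀ {x} → Nbr₂ x → Σ (Fin n) λ y → Spoke y x
  spokeInto (_ , vx₂ , ¬vx₁) with Target₂⇒middle G ¬vx₁ vx₂
  ... | y , y∉L , ((vy ∷ yx ∷ [-]) , _) = y , y∉L , vy , Adj⇒Target₁ G y∉L (proj₁ vx₂) yx

  spoke-source≢target : ∀ {y x y′ x′} → Spoke y x → Spoke y′ x′ → y ≢ x′
  spoke-source≢target (y∉L , _) (_ , _ , x′∈L , _) = ≢-sym (∈-∉-≢ x′∈L y∉L)

  open GreedyMatching Spoke (Target G 1 L) (dT 1 L) (proj₂ ∘ proj₂) spoke-source≢target Nbr₂? spokeInto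
  open Matching (greedy (allFin n))

  twoSteps : List (Fin n × Fin n) → List (Entry G)
  twoSteps = map (λ e → [ proj₁ e ] , proj₂ e)

  pathVertices-twoSteps : ∀ M → pathVertices G (twoSteps M) ≡ ends M
  pathVertices-twoSteps []            = refl
  pathVertices-twoSteps ((y , x) ∷ M) = cong (λ zs → y ∷ x ∷ zs) (pathVertices-twoSteps M)

  IsPacking-twoSteps : IsPacking G 3 L v (twoSteps pairs)
  IsPacking-twoSteps =
    All.map⁺ (All.map admissible valid) , subst Unique (sym (pathVertices-twoSteps pairs)) unique
    where
    admissible : ∀ {e} → ValidEdge e → Admissible G 3 L v [ proj₁ e ] (proj₂ e) × Target G 3 L v (proj₂ e)
    admissible {y , x} ((y∉L , vy , yx@(x∈L , _)) , _) = adm , Admissible⇒Target G x∈L adm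
      where
      v≢y : v ≢ y
      v≢y refl = irrefl vy
      adm : Admissible G 3 L v [ y ] x
      adm = path₂ G v≢y (≢-sym (∈-∉-≢ x∈L v∉L)) (≢-sym (∈-∉-≢ x∈L y∉L)) vy (Target₁⇒Adj G yx) ,
            s≤s (s≤s z≤n) , y∉L ∷ []

  #nbrs₂≤ : #nbrs₂ ≤ length pairs * p
  #nbrs₂≤ = begin
    #nbrs₂                                                      ≤⟨ sum-map-mono covered (allFin n) ⟩
    sum (map (λ x → sum (map (cover x) pairs)) (allFin n))     ≡⟨ sum-map-swap (λ x e → cover x e) (allFin n) pairs ⟩
    sum (map (λ e → sum (map (λ x → cover x e) (allFin n))) pairs)
                                                                ≤⟨ sum-map-≤-length* (All.map middle-in-R valid) ⟩
    length pairs * p                                            ∎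
    where
    open ≤-Reasoning
    cover : Fin n → Fin n × Fin n → ℕ
    cover x e = indicator (dT 1 L (proj₁ e) x)
    middle-in-R : ∀ {e} → ValidEdge e → sum (map (λ x → cover x e) (allFin n)) ≤ p
    middle-in-R ((y∉L , _) , _) = count-Target₁≤p (∉L⇒∈R y∉L)
    covered : ∀ x → indicator (Nbr₂? x) ≤ sum (map (cover x) pairs)
    covered x = indicator-≤ (Nbr₂? x)
                  (λ nbr₂ → sum-indicator-any (λ e → dT 1 L (proj₁ e) x) (covers (∈-allFin x) nbr₂))

  #nbrs+#pairs<p : Target G 1 L⁺ u v → #nbrs + length pairs < p
  #nbrs+#pairs<p uv₁ =
    subst (λ k → suc (#nbrs + k) ≤ p) (length-map _ pairs)
      (packing-bound (twoSteps pairs) (path₁ G (proj₁ (proj₂ uv₁)) (Adj-sym (Target₁⇒Adj G uv₁)) , s≤s z≤n , [])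
        IsPacking-twoSteps (λ ()) (subst (All _) (sym (pathVertices-twoSteps pairs)) fresh))
    where
    fresh : All (λ z → z ≢ u × ¬ Nbr z) (ends pairs)
    fresh = ends-All (λ (y∉L , _) → ≢-sym (∈-∉-≢ u∈L y∉L) , λ nbr → y∉L (proj₁ (proj₂ nbr)))
                     (λ (x≢u , _ , ¬vx₁) → x≢u , ¬vx₁ ∘ proj₂)
                     valid

  φ-increase₁ : Target G 1 L⁺ u v → φ G dT p L u < φ G dT p L⁺ u
  φ-increase₁ uv₁ =
    φ-increase loss (w-loss loss (λ _ → loss₁) loss₁₂ (λ _ vx₁ x≢u → ≤-trans 1≤p (loss₁ vx₁ x≢u)))
      (w-≥p² uv₁) total-loss<p²
    where
    loss : Fin n → ℕ
    loss x = indicator (Nbr? x) * p + indicator (Nbr₂? x)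
    loss₁ : ∀ {x} → Target G 1 L v x → x ≢ u → p ≤ loss x
    loss₁ {x} vx₁ x≢u = begin
      p                          ≡⟨ +-identityʳ p ⟨
      1 * p                      ≡⟨ cong (_* p) (indicator-yes (Nbr? x) (x≢u , vx₁)) ⟨
      indicator (Nbr? x) * p     ≤⟨ m≤m+n _ _ ⟩
      loss x                     ∎
      where open ≤-Reasoning
    loss₁₂ : ∀ {x} → Target G 1 L⁺ u v → Target G 2 L v x → x ≢ u → 1 ≤ loss x
    loss₁₂ {x} _ vx₂ x≢u = by-distance (dT 1 L v x)
      where
      by-distance : Dec (Target G 1 L v x) → 1 ≤ loss x
      by-distance (yes vx₁) = ≤-trans 1≤p (loss₁ vx₁ x≢u)
      by-distance (no ¬vx₁) = ≤-trans (≤-reflexive (sym (indicator-yes (Nbr₂? x) (x≢u , vx₂ , ¬vx₁)))) (m≤n+m _ _)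
    total-loss<p² : sum (map loss (allFin n)) < p * p
    total-loss<p² = begin-strict
      sum (map loss (allFin n))          ≡⟨ sum-map-+ (λ x → indicator (Nbr? x) * p) _ (allFin n) ⟩
      sum (map (λ x → indicator (Nbr? x) * p) (allFin n)) + #nbrs₂
                                         ≡⟨ cong (_+ #nbrs₂) (sum-map-*ʳ _ p (allFin n)) ⟩
      #nbrs * p + #nbrs₂                 ≤⟨ +-monoʳ-≤ (#nbrs * p) #nbrs₂≤ ⟩
      #nbrs * p + length pairs * p       ≡⟨ *-distribʳ-+ p #nbrs (length pairs) ⟨
      (#nbrs + length pairs) * p         <⟨ *-monoˡ-< p {{>-nonZero 1≤p}} (#nbrs+#pairs<p uv₁) ⟩
      p * p                              ∎
      where open ≤-Reasoning

  φ-increase-if-reachable : Target G 3 L⁺ u v → φ G dT p L u < φ G dT p L⁺ u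
  φ-increase-if-reachable uv₃ with dT 1 L⁺ u v | dT 2 L⁺ u v
  ... | yes uv₁ | _       = φ-increase₁ uv₁
  ... | no ¬uv₁ | yes uv₂ = φ-increase₂ ¬uv₁ uv₂
  ... | no ¬uv₁ | no ¬uv₂ = φ-increase₃ ¬uv₁ ¬uv₂ uv₃

lemma15 : ∀ {n} (G : Graph n) (p : ℕ) → 1 ≤ p →
          (L R : Subset n) →
          (∀ x → x ∈ L ⊎ x ∈ R) → (∀ x → x ∈ L → x ∉ R) →
          (∀ x → x ∈ R → ppAtMost G 3 L x p) →
          (v : Fin n) → v ∈ R →
          (dT : TargetDecider G) →
          (u : Fin n) → u ∈ L →
          (Target G 3 (L ∪ ⁅ v ⁆) u v → φ G dT p L u < φ G dT p (L ∪ ⁅ v ⁆) u)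
          × (¬ Target G 3 (L ∪ ⁅ v ⁆) u v → φ G dT p (L ∪ ⁅ v ⁆) u ≡ φ G dT p L u)
lemma15 G p 1≤p L R L∪R L∩R pp≤p v v∈R dT u u∈L =
  φ-increase-if-reachable , Unreachable.φ-unchanged
  where open Potential G p 1≤p L R L∪R L∩R pp≤p v v∈R dT u u∈L
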